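{- Let $\mathbf{K}=\bigcup_n\mathbf{A}_n$ be a Fraïssé structure with fixed exhaustion such that each $\mathbf{A}_n$ has finite big Ramsey degree $R_n$. Let $r<\omega$ and let $\gamma_0\ll\gamma_1\ll\cdots\ll\gamma_{r-1}$ and $\delta_0\ll\delta_1\ll\cdots\ll\delta_{r-1}$, where for each $n<r$, $\gamma_n$ and $\delta_n$ are unavoidable $R_n$-colorings of $H_n$. Then the diagrams $D_\gamma$ and $D_\delta$ are isomorphic $r$-diagrams: there are bijections $\sigma_n:\mathrm{im}(\gamma_n)\to\mathrm{im}(\delta_n)$, $n<r$, such that for all $m\le n<r$, $j\in\mathrm{im}(\gamma_n)$ and $f\in H_m^n$ we have $\sigma_m(D(\gamma_m,\gamma_n)(j,f))=D(\delta_m,\delta_n)(\sigma_n(j),f)$.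
   Context: Fraïssé: countable, every embedding of a finite substructure into $\mathbf{K}$ extends to an automorphism. Exhaustion: finite substructures $\emptyset=\mathbf{A}_0\subseteq\mathbf{A}_1\subseteq\cdots$ with union $\mathbf{K}$. $H_m=\mathrm{Emb}(\mathbf{A}_m,\mathbf{K})$, $H_m^n=\mathrm{Emb}(\mathbf{A}_m,\mathbf{A}_n)$, $\widehat G=\mathrm{Emb}(\mathbf{K},\mathbf{K})$. Big Ramsey degree of $\mathbf{A}_n$: least $\ell$ such that for all $r'>\ell$ and $\gamma:H_n\to r'$ there is $\eta\in\widehat G$ with $|\{\gamma(\eta\circ s):s\in H_n\}|\le\ell$. A coloring of $H_n$ is a map from $H_n$ to a finite set. A set $S\subseteq H_n$ is unavoidable if $\{s\in H_n:\eta\circ s\in S\}\neq\emptyset$ for all $\eta\in\widehat G$; an unavoidable $k$-coloring is a coloring with image of size $k$ and all nonempty fibers unavoidable. For a coloring $\gamma$ of $H_m$ and $\delta$ of $H_n$ ($m\le n$), $\gamma\ll\delta$ means $\delta(s_0)=\delta(s_1)\Rightarrow\gamma(s_0\circ f)=\gamma(s_1\circ f)$ for all $f\in H_m^n$, $s_0,s_1\in H_n$. In that case the diagram $D(\gamma,\delta):\mathrm{im}(\delta)\times H_m^n\to\mathrm{im}(\gamma)$ is defined by $D(\gamma,\delta)(j,f)=\gamma(s\circ f)$ for any $s\in H_n$ with $\delta(s)=j$; $D_\gamma$ denotes the family $\{D(\gamma_m,\gamma_n):m\le n<r\}$. -}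

module Defs where

open import Level using (0ℓ)
open import Data.Nat using (ℕ; zero; suc; _≤_; _<_)
open import Data.Fin using (Fin)
open import Data.Vec using (Vec; lookup; map)
open import Data.Vec.Properties using (lookup-map; map-cong; map-∘)
open import Data.Product using (Σ; ∃; ∃₂; _×_; _,_; proj₁; proj₂)
open import Function using (_∘_; _⇔_; Equivalence; mk⇔)
open import Function.Bundles using (Bijection; Injection)
open import Relation.Binary.Bundles using (Setoid)
open import Relation.Binary.PropositionalEquality

record Signature : Set₁ where
  field
    Fun   : Set
    funAr : Fun → ℕ
    Rel   : Set
    relAr : Rel → ℕ

open Signature public

record Structure (L : Signature) (C : Set) : Set₁ where
  field
    fun : (f : Fun L) → Vec C (funAr L f) → C
    rel : (R : Rel L) → Vec C (relAr L R) → Set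

open Structure public

record IsEmbedding {L : Signature} {C D : Set}
         (A : Structure L C) (B : Structure L D) (h : C → D) : Set where
  field
    inj      : ∀ {x y} → h x ≡ h y → x ≡ y
    pres-fun : ∀ f xs → h (fun A f xs) ≡ fun B f (map h xs)
    pres-rel : ∀ R xs → rel A R xs ⇔ rel B R (map h xs)

record Emb {L : Signature} {C D : Set} (A : Structure L C) (B : Structure L D) : Set where
  constructor emb
  field
    fn     : C → D
    .isEmb : IsEmbedding A B fn

record FinEmb {L : Signature} {k : ℕ} {D : Set}
         (A : Structure L (Fin k)) (B : Structure L D) : Set where
  constructor finEmb
  field
    vec    : Vec D k
    .isEmb : IsEmbedding A B (lookup vec)

isEmb-≗ : ∀ {L C D} {A : Structure L C} {B : Structure L D} {h h' : C → D} →
          (∀ x → h x ≡ h' x) → IsEmbedding A B h → IsEmbedding A B h'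
isEmb-≗ {A = A} {B} {h} {h'} eq e = record
  { inj = λ {x} {y} p → IsEmbedding.inj e (trans (eq x) (trans p (sym (eq y))))
  ; pres-fun = λ f xs → trans (sym (eq (fun A f xs)))
                 (trans (IsEmbedding.pres-fun e f xs) (cong (fun B f) (map-cong eq xs)))
  ; pres-rel = λ R xs → let q = cong (rel B R) (map-cong eq xs)
                            e' = IsEmbedding.pres-rel e R xs in
      mk⇔ (λ a → subst (λ X → X) q (Equivalence.to e' a))
          (λ b → Equivalence.from e' (subst (λ X → X) (sym q) b))
  }

isEmb-∘ : ∀ {L C D E} {A : Structure L C} {B : Structure L D} {G : Structure L E}
          {g : D → E} {h : C → D} → IsEmbedding B G g → IsEmbedding A B h →
          IsEmbedding A G (g ∘ h)
isEmb-∘ {A = A} {B} {G} {g} {h} eg eh = record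
  { inj = λ p → IsEmbedding.inj eh (IsEmbedding.inj eg p)
  ; pres-fun = λ f xs → trans (cong g (IsEmbedding.pres-fun eh f xs))
                 (trans (IsEmbedding.pres-fun eg f (map h xs)) (cong (fun G f) (sym (map-∘ g h xs))))
  ; pres-rel = λ R xs → let q = cong (rel G R) (sym (map-∘ g h xs))
                            e1 = IsEmbedding.pres-rel eh R xs
                            e2 = IsEmbedding.pres-rel eg R (map h xs) in
      mk⇔ (λ a → subst (λ X → X) q (Equivalence.to e2 (Equivalence.to e1 a)))
          (λ b → Equivalence.from e1 (Equivalence.from e2 (subst (λ X → X) (sym q) b)))
  }

post : ∀ {L k D E} {A : Structure L (Fin k)} {B : Structure L D} {G : Structure L E} →
       Emb B G → FinEmb A B → FinEmb A G
post (emb g eg) (finEmb v ev) =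
  finEmb (map g v) (isEmb-≗ (λ i → sym (lookup-map i g v)) (isEmb-∘ eg ev))

toEmb : ∀ {L k D} {A : Structure L (Fin k)} {B : Structure L D} → FinEmb A B → Emb A B
toEmb (finEmb v ev) = emb (lookup v) ev

record FinSub {L : Signature} {C : Set} (K : Structure L C) : Set where
  field
    size      : ℕ
    elems     : Vec C size
    elems-inj : ∀ {i j} → lookup elems i ≡ lookup elems j → i ≡ j
    closed    : ∀ f (xs : Vec (Fin size) (funAr L f)) →
                Σ (Fin size) λ i → lookup elems i ≡ fun K f (map (lookup elems) xs)

open FinSub public

induced : ∀ {L C} {K : Structure L C} (A : FinSub K) → Structure L (Fin (size A))
induced {K = K} A = record
  { fun = λ f xs → proj₁ (closed A f xs)
  ; rel = λ R xs → rel K R (map (lookup (elems A)) xs) }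

record Exhaustion {L : Signature} {C : Set} (K : Structure L C) : Set where
  field
    A      : ℕ → FinSub K
    empty₀ : size (A 0) ≡ 0
    mono   : ∀ n (i : Fin (size (A n))) →
             ∃ λ (j : Fin (size (A (suc n)))) → lookup (elems (A (suc n))) j ≡ lookup (elems (A n)) i
    cover  : ∀ (x : C) → ∃₂ λ n (i : Fin (size (A n))) → lookup (elems (A n)) i ≡ x

open Exhaustion public

record IsFraisse {L : Signature} {C : Set} (K : Structure L C) : Set where
  field
    countable   : Σ (C → ℕ) λ g → ∀ {x y} → g x ≡ g y → x ≡ y
    homogeneous : (B : FinSub K) (e : FinEmb (induced B) K) →
                  Σ (Emb K K) λ g → (∀ y → ∃ λ x → Emb.fn g x ≡ y) ×
                    (∀ i → Emb.fn g (lookup (elems B) i) ≡ lookup (FinEmb.vec e) i)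

Im : ∀ {X : Set} {c : ℕ} → (X → Fin c) → Setoid 0ℓ 0ℓ
Im {X} {c} γ = record
  { Carrier = Σ (Fin c) λ j → ∃ λ x → γ x ≡ j
  ; _≈_ = λ a b → proj₁ a ≡ proj₁ b
  ; isEquivalence = record { refl = refl ; sym = sym ; trans = trans } }

HasSize : Setoid 0ℓ 0ℓ → ℕ → Set
HasSize S k = Bijection S (setoid (Fin k))

AtMost : Setoid 0ℓ 0ℓ → ℕ → Set
AtMost S ℓ = Injection S (setoid (Fin ℓ))

module _ {L : Signature} {C : Set} (K : Structure L C) (E : Exhaustion K) where

  H : ℕ → Set
  H m = FinEmb (induced (A E m)) K

  Hmn : ℕ → ℕ → Set
  Hmn m n = FinEmb (induced (A E m)) (induced (A E n))

  compH : ∀ {m n} → H n → Hmn m n → H m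
  compH s f = post (toEmb s) f

  act : ∀ {n} → Emb K K → H n → H n
  act η s = post η s

  BRBound : ℕ → ℕ → Set
  BRBound n ℓ = ∀ r' → ℓ < r' → (γ : H n → Fin r') →
                ∃ λ (η : Emb K K) → AtMost (Im (λ s → γ (act η s))) ℓ

  IsBigRamseyDegree : ℕ → ℕ → Set
  IsBigRamseyDegree n R = BRBound n R × (∀ ℓ → BRBound n ℓ → R ≤ ℓ)

  Unavoidable : ∀ {n} → (H n → Set) → Set
  Unavoidable {n} S = ∀ (η : Emb K K) → ∃ λ (s : H n) → S (act η s)

  UnavoidableColoring : ∀ n (k : ℕ) {c : ℕ} → (H n → Fin c) → Set
  UnavoidableColoring n k γ =
    HasSize (Im γ) k ×
    (∀ j → (∃ λ s → γ s ≡ j) → Unavoidable (λ s → γ s ≡ j))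

  _≪_ : ∀ {m n c d} → (H m → Fin c) → (H n → Fin d) → Set
  _≪_ {m} {n} γ δ = ∀ (f : Hmn m n) (s₀ s₁ : H n) →
                     δ s₀ ≡ δ s₁ → γ (compH s₀ f) ≡ γ (compH s₁ f)

  Diag : ∀ {m n c d} (γ : H m → Fin c) (δ : H n → Fin d) →
         Setoid.Carrier (Im δ) → Hmn m n → Setoid.Carrier (Im γ)
  Diag γ δ (j , s , p) f = γ (compH s f) , compH s f , refl

-- Fix one embedding η of K into itself for all levels n < r at once, so that on the copy
-- η ∘ H_n the colorings γ_n and δ_n induce the same partition.  Such an η exists level by
-- level: colour H_n by the pair (γ_n, δ_n) and pass to a copy on which this pair coloring
-- takes at most R_n colours.  Since γ_n has R_n unavoidable classes, a coloring with at most
-- R_n colours refining γ_n on a copy induces exactly the partition of γ_n there, so γ_n and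
-- δ_n determine each other; the property survives further shrinking, so the levels can be
-- handled one after the other.  Then σ_n sends the γ_n-colour of η ∘ s to its δ_n-colour, and
-- the diagrams commute because γ_m ≪ γ_n lets us compute D(γ_m,γ_n) on the copy.
module Submission where

open import Defs
open import Data.Nat using (ℕ; suc; _+_; _*_)
open import Data.Nat.Properties using (n<1+n; m≤n+m)
open import Data.Fin using (Fin; toℕ; _≤_; zero; suc; _↑ˡ_; combine)
open import Data.Fin.Properties using (pigeonhole; <⇒≢; ↑ˡ-injective; combine-injective)
open import Data.Product using (Σ; ∃; _×_; _,_; proj₁; proj₂)
open import Data.Vec using (Vec; lookup)
open import Data.Vec.Properties using (map-∘; map-cong; lookup-map; map-id)
open import Data.List using (List; []; _∷_; allFin)
open import Data.List.Membership.Propositional using (_∈_)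
open import Data.List.Membership.Propositional.Properties using (∈-allFin)
open import Data.List.Relation.Unary.Any using (here; there)
open import Function using (_∘_; id; mk⇔)
open import Function.Bundles using (Bijection; Injection)
open import Function.Definitions using (Injective)
open import Relation.Nullary using (contradiction)
open import Relation.Binary.Bundles using (Setoid)
open import Relation.Binary.PropositionalEquality
  using (_≡_; _≗_; refl; sym; trans; cong; subst; module ≡-Reasoning)

open Setoid using (Carrier)

injective⇒surjective : ∀ {n} (h : Fin n → Fin n) → Injective _≡_ _≡_ h →
                       ∀ y → ∃ λ i → h i ≡ y
injective⇒surjective {n} h h-injective y with pigeonhole (n<1+n n) y∷h
  where
    y∷h : Fin (suc n) → Fin n
    y∷h zero    = y
    y∷h (suc i) = h i
... | zero  , suc j , _   , y≡hj  = j , sym y≡hj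
... | suc i , suc j , i<j , hi≡hj = contradiction (cong suc (h-injective hi≡hj)) (<⇒≢ i<j)

Refines : ∀ {X A B : Set} → (X → A) → (X → B) → Set
Refines a b = ∀ x y → a x ≡ a y → b x ≡ b y

SamePartition : ∀ {X A B : Set} → (X → A) → (X → B) → Set
SamePartition a b = Refines a b × Refines b a

refines-respʳ-≗ : ∀ {X A B : Set} {a : X → A} {b b' : X → B} →
                  b ≗ b' → Refines a b → Refines a b'
refines-respʳ-≗ b≗b' a⊑b x y eq = trans (sym (b≗b' x)) (trans (a⊑b x y eq) (b≗b' y))

refines-combine : ∀ {X A : Set} {c d : ℕ} {g : X → A} (a : X → Fin c) (b : X → Fin d) →
                  Refines g (λ x → combine (a x) (b x)) → Refines g a × Refines g b
refines-combine a b g⊑ab =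
  (λ x y eq → proj₁ (combine-injective (a x) (b x) (a y) (b y) (g⊑ab x y eq))) ,
  (λ x y eq → proj₂ (combine-injective (a x) (b x) (a y) (b y) (g⊑ab x y eq)))

-- g ∘ t injects Fin R into itself, so every g-class meets t; hence the g-classes are a-classes.
refines-via-small-common-refinement :
  ∀ {X A B : Set} {R : ℕ} (a : X → A) (b : X → B) (g : X → Fin R) (t : Fin R → X) →
  Injective _≡_ _≡_ (a ∘ t) → Refines g a → Refines g b → Refines a b
refines-via-small-common-refinement a b g t a∘t-injective g⊑a g⊑b x y ax≡ay =
  begin
    b x        ≡⟨ sym (g⊑b (t ix) x gix≡gx) ⟩
    b (t ix)   ≡⟨ cong (b ∘ t) ix≡iy ⟩
    b (t iy)   ≡⟨ g⊑b (t iy) y giy≡gy ⟩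
    b y        ∎
  where
    open ≡-Reasoning
    g∘t-injective : Injective _≡_ _≡_ (g ∘ t)
    g∘t-injective {i} {j} eq = a∘t-injective (g⊑a (t i) (t j) eq)
    index : ∀ z → ∃ λ i → g (t i) ≡ g z
    index z = injective⇒surjective (g ∘ t) g∘t-injective (g z)
    ix = proj₁ (index x)
    iy = proj₁ (index y)
    gix≡gx = proj₂ (index x)
    giy≡gy = proj₂ (index y)
    ix≡iy : ix ≡ iy
    ix≡iy = a∘t-injective
      (trans (g⊑a (t ix) x gix≡gx) (trans ax≡ay (sym (g⊑a (t iy) y giy≡gy))))

ColoursAttainedAlong : ∀ {X X' : Set} {c : ℕ} → (X → Fin c) → (X' → X) → Set
ColoursAttainedAlong a e = ∀ j → (∃ λ x → a x ≡ j) → ∃ λ x' → a (e x') ≡ j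

distinct-representatives :
  ∀ {X X' : Set} {c R : ℕ} (a : X → Fin c) (e : X' → X) →
  HasSize (Im a) R → ColoursAttainedAlong a e →
  Σ (Fin R → X') λ t → Injective _≡_ _≡_ (a ∘ e ∘ t)
distinct-representatives a e size attained = t , t-injective
  where
    open Bijection size using (to⁻; strictlySurjective)
    t : Fin _ → _
    t i = proj₁ (attained (proj₁ (to⁻ i)) (proj₂ (to⁻ i)))
    colour-t : ∀ i → a (e (t i)) ≡ proj₁ (to⁻ i)
    colour-t i = proj₂ (attained (proj₁ (to⁻ i)) (proj₂ (to⁻ i)))
    t-injective : Injective _≡_ _≡_ (a ∘ e ∘ t)
    t-injective {i} {j} eq =
      trans (sym (proj₂ (strictlySurjective i)))
        (trans (Bijection.cong size (trans (sym (colour-t i)) (trans eq (colour-t j))))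
          (proj₂ (strictlySurjective j)))

module Transfer {X X' : Set} {c d : ℕ} (a : X → Fin c) (b : X → Fin d) (e : X' → X)
    (a-attained : ColoursAttainedAlong a e) (b-attained : ColoursAttainedAlong b e)
    (same : SamePartition (a ∘ e) (b ∘ e)) where

  representative : Carrier (Im a) → X'
  representative (j , w) = proj₁ (a-attained j w)

  representative-colour : ∀ y → a (e (representative y)) ≡ proj₁ y
  representative-colour (j , w) = proj₂ (a-attained j w)

  transfer : Carrier (Im a) → Carrier (Im b)
  transfer y = b (e (representative y)) , e (representative y) , refl

  transfer-along : ∀ x' → proj₁ (transfer (a (e x') , e x' , refl)) ≡ b (e x')
  transfer-along x' = proj₁ same (representative (a (e x') , e x' , refl)) x'
    (representative-colour (a (e x') , e x' , refl))

  transfer-cong : ∀ {y y'} → proj₁ y ≡ proj₁ y' → proj₁ (transfer y) ≡ proj₁ (transfer y')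
  transfer-cong {y} {y'} y≈y' = proj₁ same (representative y) (representative y')
    (trans (representative-colour y) (trans y≈y' (sym (representative-colour y'))))

  transfer-injective : ∀ {y y'} → proj₁ (transfer y) ≡ proj₁ (transfer y') → proj₁ y ≡ proj₁ y'
  transfer-injective {y} {y'} eq =
    begin
      proj₁ y                    ≡⟨ sym (representative-colour y) ⟩
      a (e (representative y))   ≡⟨ proj₂ same (representative y) (representative y') eq ⟩
      a (e (representative y'))  ≡⟨ representative-colour y' ⟩
      proj₁ y'                   ∎
    where open ≡-Reasoning

  transfer-surjective : ∀ z → ∃ λ y → ∀ {y'} → proj₁ y' ≡ proj₁ y → proj₁ (transfer y') ≡ proj₁ z
  transfer-surjective (k , w) = y , λ {y'} y'≈y →
      trans (transfer-cong {y'} {y} y'≈y) (trans (transfer-along x') (proj₂ (b-attained k w)))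
    where
      x' = proj₁ (b-attained k w)
      y = a (e x') , e x' , refl

  bijection : Bijection (Im a) (Im b)
  bijection = record
    { to        = transfer
    ; cong      = transfer-cong
    ; bijective = transfer-injective , transfer-surjective
    }

finEmb-≡ : ∀ {L k D} {A : Structure L (Fin k)} {B : Structure L D} {v w : Vec D k}
           .{p : IsEmbedding A B (lookup v)} .{q : IsEmbedding A B (lookup w)} →
           v ≡ w → finEmb {A = A} {B = B} v p ≡ finEmb w q
finEmb-≡ refl = refl

module _ {L : Signature} {C : Set} (K : Structure L C) (E : Exhaustion K) where

  idE : Emb K K
  idE = emb id record
    { inj      = id
    ; pres-fun = λ f xs → cong (fun K f) (sym (map-id xs))
    ; pres-rel = λ R xs → mk⇔ (subst (rel K R) (sym (map-id xs))) (subst (rel K R) (map-id xs))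
    }

  _∘E_ : Emb K K → Emb K K → Emb K K
  emb g eg ∘E emb h eh = emb (g ∘ h) (isEmb-∘ eg eh)

  act-∘ : ∀ {n} η η' (s : H K E n) → act K E (η ∘E η') s ≡ act K E η (act K E η' s)
  act-∘ (emb g _) (emb h _) (finEmb v _) = finEmb-≡ (map-∘ g h v)

  compH-act : ∀ {m n} η (s : H K E n) (f : Hmn K E m n) →
              compH K E (act K E η s) f ≡ act K E η (compH K E s f)
  compH-act (emb g _) (finEmb vs _) (finEmb vf _) =
    finEmb-≡ (trans (map-cong (λ i → lookup-map i g vs) vf) (map-∘ g (lookup vs) vf))

  refines-∘E : ∀ {n} {A B : Set} (a : H K E n → A) (b : H K E n → B) η η' →
               Refines (a ∘ act K E η) (b ∘ act K E η) →
               Refines (a ∘ act K E (η ∘E η')) (b ∘ act K E (η ∘E η'))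
  refines-∘E a b η η' a⊑b x y eq rewrite act-∘ η η' x | act-∘ η η' y =
    a⊑b (act K E η' x) (act K E η' y) eq

  samePartition-∘E : ∀ {n} {A B : Set} (a : H K E n → A) (b : H K E n → B) η η' →
                     SamePartition (a ∘ act K E η) (b ∘ act K E η) →
                     SamePartition (a ∘ act K E (η ∘E η')) (b ∘ act K E (η ∘E η'))
  samePartition-∘E a b η η' (a⊑b , b⊑a) = refines-∘E a b η η' a⊑b , refines-∘E b a η η' b⊑a

  simultaneously : {I : Set} (P : I → Emb K K → Set) →
                   (∀ {i η} η' → P i η → P i (η ∘E η')) →
                   (∀ i η → ∃ λ η' → P i (η ∘E η')) →
                   (is : List I) → ∃ λ η → ∀ {i} → i ∈ is → P i η
  simultaneously P stable improve []       = idE , λ ()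
  simultaneously P stable improve (i ∷ is) = η ∘E η' , holds
    where
      η  = proj₁ (simultaneously P stable improve is)
      η' = proj₁ (improve i η)
      holds : ∀ {k} → k ∈ i ∷ is → P k (η ∘E η')
      holds (here refl) = proj₂ (improve i η)
      holds (there k∈is) = stable η' (proj₂ (simultaneously P stable improve is) k∈is)

  -- BRBound only speaks of colorings with more than ℓ colours, hence the padding with ↑ˡ.
  small-refinement-on-copy : ∀ {n ℓ N} → BRBound K E n ℓ → (κ : H K E n → Fin N) →
                             ∃ λ η → Σ (H K E n → Fin ℓ) λ g → Refines g (κ ∘ act K E η)
  small-refinement-on-copy {n} {ℓ} {N} bound κ = η , g , g⊑κ
    where
      padded : H K E n → Fin (N + suc ℓ)
      padded s = κ s ↑ˡ suc ℓ
      few = bound (N + suc ℓ) (m≤n+m (suc ℓ) N) padded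
      η = proj₁ few
      g : H K E n → Fin ℓ
      g s = Injection.to (proj₂ few) (padded (act K E η s) , s , refl)
      g⊑κ : Refines g (κ ∘ act K E η)
      g⊑κ _ _ eq = ↑ˡ-injective (suc ℓ) _ _ (Injection.injective (proj₂ few) eq)

  same-partition-on-copy :
    ∀ {n R c d} (a : H K E n → Fin c) (b : H K E n → Fin d) →
    BRBound K E n R → UnavoidableColoring K E n R a → UnavoidableColoring K E n R b →
    ∀ η → ∃ λ η' → SamePartition (a ∘ act K E (η ∘E η')) (b ∘ act K E (η ∘E η'))
  same-partition-on-copy {n} {R} {c} {d} a b bound
    (a-size , a-unavoidable) (b-size , b-unavoidable) η =
    η' , refines-via-small-common-refinement a' b' g ta ta-injective g⊑a' g⊑b'
       , refines-via-small-common-refinement b' a' g tb tb-injective g⊑b' g⊑a'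
    where
      pair : H K E n → Fin (c * d)
      pair s = combine (a (act K E η s)) (b (act K E η s))
      few = small-refinement-on-copy bound pair
      η' = proj₁ few
      g : H K E n → Fin R
      g = proj₁ (proj₂ few)
      a' : H K E n → Fin c
      a' = a ∘ act K E (η ∘E η')
      b' : H K E n → Fin d
      b' = b ∘ act K E (η ∘E η')
      g⊑a,b : Refines g (a ∘ act K E η ∘ act K E η') × Refines g (b ∘ act K E η ∘ act K E η')
      g⊑a,b = refines-combine (a ∘ act K E η ∘ act K E η') (b ∘ act K E η ∘ act K E η')
                (proj₂ (proj₂ few))
      act-∘˘ : ∀ s → act K E η (act K E η' s) ≡ act K E (η ∘E η') s
      act-∘˘ s = sym (act-∘ η η' s)
      g⊑a' : Refines g a'
      g⊑a' = refines-respʳ-≗ (cong a ∘ act-∘˘) (proj₁ g⊑a,b)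
      g⊑b' : Refines g b'
      g⊑b' = refines-respʳ-≗ (cong b ∘ act-∘˘) (proj₂ g⊑a,b)
      a-reps = distinct-representatives a (act K E (η ∘E η')) a-size
                 (λ j w → a-unavoidable j w (η ∘E η'))
      b-reps = distinct-representatives b (act K E (η ∘E η')) b-size
                 (λ j w → b-unavoidable j w (η ∘E η'))
      ta = proj₁ a-reps
      ta-injective = proj₂ a-reps
      tb = proj₁ b-reps
      tb-injective = proj₂ b-reps

module ColourBijection {L : Signature} {C : Set} (K : Structure L C) (E : Exhaustion K)
    {r : ℕ} {cγ cδ : Fin r → ℕ}
    (γ : (n : Fin r) → H K E (toℕ n) → Fin (cγ n))
    (δ : (n : Fin r) → H K E (toℕ n) → Fin (cδ n))
    (γ-unavoidable : ∀ n j → (∃ λ s → γ n s ≡ j) → Unavoidable K E (λ s → γ n s ≡ j))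
    (δ-unavoidable : ∀ n j → (∃ λ s → δ n s ≡ j) → Unavoidable K E (λ s → δ n s ≡ j))
    (η : Emb K K) (agree : ∀ n → SamePartition (γ n ∘ act K E η) (δ n ∘ act K E η)) where

  private
    module T (n : Fin r) = Transfer (γ n) (δ n) (act K E η)
      (λ j w → γ-unavoidable n j w η) (λ j w → δ-unavoidable n j w η) (agree n)

  σ : ∀ n → Bijection (Im (γ n)) (Im (δ n))
  σ = T.bijection

  σ-commutes : ∀ m n → _≪_ K E (γ m) (γ n) →
               ∀ (j : Carrier (Im (γ n))) (f : Hmn K E (toℕ m) (toℕ n)) →
               proj₁ (Bijection.to (σ m) (Diag K E (γ m) (γ n) j f))
                 ≡ proj₁ (Diag K E (δ m) (δ n) (Bijection.to (σ n) j) f)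
  σ-commutes m n γm≪γn (j , s , p) f =
    begin
      proj₁ (T.transfer m (Diag K E (γ m) (γ n) (j , s , p) f))
        ≡⟨ Bijection.cong (σ m) (trans same-γn-colour (cong (γ m) (compH-act K E η t f))) ⟩
      proj₁ (T.transfer m (γ m (act K E η (compH K E t f)) , act K E η (compH K E t f) , refl))
        ≡⟨ T.transfer-along m (compH K E t f) ⟩
      δ m (act K E η (compH K E t f))
        ≡⟨ cong (δ m) (sym (compH-act K E η t f)) ⟩
      δ m (compH K E (act K E η t) f)
    ∎
    where
      open ≡-Reasoning
      t = T.representative n (j , s , p)
      same-γn-colour : γ m (compH K E s f) ≡ γ m (compH K E (act K E η t) f)
      same-γn-colour = γm≪γn f s (act K E η t)
                         (trans p (sym (T.representative-colour n (j , s , p))))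

proposition7p4 : {L : Signature} {C : Set} (K : Structure L C) (E : Exhaustion K) →
    IsFraisse K →
    (R : ℕ → ℕ) → (∀ n → IsBigRamseyDegree K E n (R n)) →
    (r : ℕ) (cγ cδ : Fin r → ℕ) →
    (γ : (n : Fin r) → H K E (toℕ n) → Fin (cγ n)) →
    (δ : (n : Fin r) → H K E (toℕ n) → Fin (cδ n)) →
    (∀ n → UnavoidableColoring K E (toℕ n) (R (toℕ n)) (γ n)) →
    (∀ n → UnavoidableColoring K E (toℕ n) (R (toℕ n)) (δ n)) →
    (∀ m n → m ≤ n → _≪_ K E (γ m) (γ n)) →
    (∀ m n → m ≤ n → _≪_ K E (δ m) (δ n)) →
    Σ ((n : Fin r) → Bijection (Im (γ n)) (Im (δ n))) λ σ →
    ∀ (m n : Fin r) → m ≤ n →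
    ∀ (j : Setoid.Carrier (Im (γ n))) (f : Hmn K E (toℕ m) (toℕ n)) →
    proj₁ (Bijection.to (σ m) (Diag K E (γ m) (γ n) j f))
    ≡ proj₁ (Diag K E (δ m) (δ n) (Bijection.to (σ n) j) f)
proposition7p4 K E _ R degree r cγ cδ γ δ γ-unavoidable δ-unavoidable γ≪γ _ =
  σ , λ m n m≤n → σ-commutes m n (γ≪γ m n m≤n)
  where
    Agree : Fin r → Emb K K → Set
    Agree n η = SamePartition (γ n ∘ act K E η) (δ n ∘ act K E η)
    agreeing : ∃ λ η → ∀ {n} → n ∈ allFin r → Agree n η
    agreeing = simultaneously K E Agree
      (λ {n} {η} η' → samePartition-∘E K E (γ n) (δ n) η η')
      (λ n → same-partition-on-copy K E (γ n) (δ n) (proj₁ (degree (toℕ n)))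
               (γ-unavoidable n) (δ-unavoidable n))
      (allFin r)
    open ColourBijection K E γ δ (proj₂ ∘ γ-unavoidable) (proj₂ ∘ δ-unavoidable)
      (proj₁ agreeing) (λ n → proj₂ agreeing (∈-allFin n))
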